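{- Let $G=(V,E)$ be a finite simple graph and let $e=\{u,v\}\in E$. Then \[ p_u(G-e,x)=p_{u,v}(G,x)+p_u(G,x). \]
   Context: A set $W$ of vertices of a graph $H$ is a dominating set if every vertex of $H$ is in $W$ or adjacent to a vertex of $W$. $N_G(u)$ denotes the open neighborhood of $u$ in $G$. - For a vertex $u$ of a graph $H$, $p_u(H,x)$ is the sum of $x^{|W|}$ over all dominating sets $W$ of $H-u$ that contain no vertex of $N_H(u)$. - For an edge $\{u,v\}$ of $G$, $p_{u,v}(G,x)$ is the sum of $x^{|W|}$ over all dominating sets $W$ of $G-u$ such that $v\in W$ and $W$ contains no vertex of $N_G(u)$ other than $v$. - $G-e$ removes the edge $e$, and $G-u$ removes the vertex $u$. -}

module Defs where

open import Data.Bool using (Bool; true; false; _∧_; _∨_; not)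
open import Data.Bool.Properties using (∧-comm; ∨-comm)
open import Data.Nat using (ℕ; zero; suc)
open import Data.Fin using (Fin; _≟_)
open import Data.Fin.Subset using (Subset; ∣_∣)
open import Data.Vec using (Vec; []; _∷_; lookup)
open import Data.List using (List; []; _∷_; map; _++_; length; filterᵇ; allFin)
open import Data.Bool.ListAction using (all; any)
open import Relation.Nullary.Decidable using (⌊_⌋)
open import Relation.Binary.PropositionalEquality using (_≡_; refl)
import Data.Nat as ℕ

record Graph (n : ℕ) : Set where
  field
    adj    : Fin n → Fin n → Bool
    sym    : ∀ a b → adj a b ≡ adj b a
    irrefl : ∀ a → adj a a ≡ false
open Graph public

_==_ : ∀ {n} → Fin n → Fin n → Bool
a == b = ⌊ a ≟ b ⌋

private
  symLemma : ∀ x p q r s → x ∧ not ((p ∧ q) ∨ (r ∧ s)) ≡ x ∧ not ((s ∧ r) ∨ (q ∧ p))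
  symLemma x p q r s rewrite ∧-comm s r | ∧-comm q p | ∨-comm (r ∧ s) (p ∧ q) = refl

  irrLemma : ∀ y → false ∧ y ≡ false
  irrLemma y = refl

removeEdge : ∀ {n} → Graph n → Fin n → Fin n → Graph n
adj (removeEdge G u v) a b =
  adj G a b ∧ not (((a == u) ∧ (b == v)) ∨ ((a == v) ∧ (b == u)))
sym (removeEdge G u v) a b rewrite sym G a b =
  symLemma (adj G b a) (a == u) (b == v) (a == v) (b == u)
irrefl (removeEdge G u v) a rewrite irrefl G a = refl

allSubsets : (n : ℕ) → List (Subset n)
allSubsets zero    = [] ∷ []
allSubsets (suc n) = map (true ∷_) (allSubsets n) ++ map (false ∷_) (allSubsets n)

mem : ∀ {n} → Fin n → Subset n → Bool
mem w W = lookup W w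

-- W is a dominating set of G - u : W ⊆ V(G) ∖ {u}, and every vertex w ≠ u
-- is in W or adjacent (in G, equivalently in G - u) to some vertex of W.
dominatesMinus : ∀ {n} → Graph n → Fin n → Subset n → Bool
dominatesMinus {n} G u W =
  not (mem u W) ∧
  all (λ w → (w == u) ∨ mem w W ∨ any (λ z → mem z W ∧ adj G z w) (allFin n)) (allFin n)

avoidsNbhd : ∀ {n} → Graph n → Fin n → Subset n → Bool
avoidsNbhd {n} G u W = all (λ z → not (adj G u z ∧ mem z W)) (allFin n)

avoidsNbhdExcept : ∀ {n} → Graph n → Fin n → Fin n → Subset n → Bool
avoidsNbhdExcept {n} G u v W =
  all (λ z → (z == v) ∨ not (adj G u z ∧ mem z W)) (allFin n)

-- A polynomial in x with natural coefficients is given by its coefficient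
-- function; the coefficient of x^k in Σ_{W ∈ 𝒮} x^|W| is #{W ∈ 𝒮 : |W| = k}.
Poly : Set
Poly = ℕ → ℕ

genPoly : ∀ {n} → (Subset n → Bool) → Poly
genPoly {n} P k = length (filterᵇ (λ W → P W ∧ ⌊ ∣ W ∣ ℕ.≟ k ⌋) (allSubsets n))

p-vertex : ∀ {n} → Graph n → Fin n → Poly
p-vertex G u = genPoly (λ W → dominatesMinus G u W ∧ avoidsNbhd G u W)

p-edge : ∀ {n} → Graph n → Fin n → Fin n → Poly
p-edge G u v = genPoly (λ W → dominatesMinus G u W ∧ mem v W ∧ avoidsNbhdExcept G u v W)

module Submission where

-- Deleting e only changes adjacencies at u, and u is not a vertex
-- of G - u, so W dominates (G - e) - u iff it dominates G - u.  The
-- neighbourhood of u shrinks from N_G(u) to N_G(u) ∖ {v}, so the sets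
-- counted by p_u(G - e) are the dominating sets of G - u meeting N_G(u) at
-- most in v.  Splitting them according to whether v ∈ W gives exactly the
-- sets counted by p_{u,v}(G) (v ∈ W) and by p_u(G) (v ∉ W).

open import Defs hiding (sym)
open import Data.Nat using (ℕ; _+_; suc)
open import Data.Nat.Properties using (+-suc)
open import Data.Fin using (Fin; _≟_)
open import Data.Fin.Subset using (Subset; ∣_∣)
open import Data.Bool using (Bool; true; false; _∧_; _∨_; not)
open import Data.Bool.Properties
  using (∧-comm; ∧-zeroʳ; ∧-identityʳ; ∨-identityʳ; ∧-distribˡ-∨; ∧-distribʳ-∨)
open import Data.Bool.ListAction using (all; any; and; or)
open import Data.List using (List; []; _∷_; length; filterᵇ; allFin)
open import Data.List.Properties using (map-cong)
open import Data.List.Membership.Propositional using (_∈_)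
open import Data.List.Membership.Propositional.Properties using (∈-allFin)
open import Data.List.Relation.Unary.Any using (here; there)
open import Data.Sum using (_⊎_; inj₁; inj₂)
open import Relation.Nullary using (¬_; Dec; yes; no; contradiction)
open import Relation.Nullary.Decidable using (isYes; isYes≗does; dec-true; dec-false)
import Data.Nat as ℕ
open import Relation.Binary.PropositionalEquality
  using (_≡_; refl; sym; trans; cong; cong₂; module ≡-Reasoning)

length-filter-partition : ∀ {A : Set} (f g h : A → Bool) (xs : List A) →
  (∀ x → f x ≡ g x ∨ h x) → (∀ x → g x ∧ h x ≡ false) →
  length (filterᵇ f xs) ≡ length (filterᵇ g xs) + length (filterᵇ h xs)
length-filter-partition f g h [] union disjoint = refl
length-filter-partition f g h (x ∷ xs) union disjoint
  with f x | g x | h x | union x | disjoint x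
     | length-filter-partition f g h xs union disjoint
... | .true  | true  | false | refl | _  | ih = cong suc ih
... | .true  | false | true  | refl | _  | ih = trans (cong suc ih) (sym (+-suc _ _))
... | .false | false | false | refl | _  | ih = ih
... | .true  | true  | true  | refl | () | _

restrictˡ-disjoint : ∀ d y z → y ∧ z ≡ false → (d ∧ y) ∧ (d ∧ z) ≡ false
restrictˡ-disjoint true  y z y∧z≡false = y∧z≡false
restrictˡ-disjoint false y z y∧z≡false = refl

restrictʳ-disjoint : ∀ c y z → y ∧ z ≡ false → (y ∧ c) ∧ (z ∧ c) ≡ false
restrictʳ-disjoint c y z y∧z≡false =
  trans (cong₂ _∧_ (∧-comm y c) (∧-comm z c)) (restrictˡ-disjoint c y z y∧z≡false)

genPoly-split : ∀ {n} (P Q R : Subset n → Bool) →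
  (∀ W → P W ≡ Q W ∨ R W) → (∀ W → Q W ∧ R W ≡ false) →
  ∀ k → genPoly P k ≡ genPoly Q k + genPoly R k
genPoly-split {n} P Q R union disjoint k =
  length-filter-partition _ _ _ (allSubsets n)
    (λ W → trans (cong (_∧ size≡k W) (union W)) (∧-distribʳ-∨ (size≡k W) (Q W) (R W)))
    (λ W → restrictʳ-disjoint (size≡k W) (Q W) (R W) (disjoint W))
  where
  size≡k : Subset n → Bool
  size≡k W = isYes (∣ W ∣ ℕ.≟ k)

all-cong : ∀ {A : Set} {f g : A → Bool} (xs : List A) →
  (∀ x → f x ≡ g x) → all f xs ≡ all g xs
all-cong xs f≗g = cong and (map-cong f≗g xs)

any-cong : ∀ {A : Set} {f g : A → Bool} (xs : List A) →
  (∀ x → f x ≡ g x) → any f xs ≡ any g xs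
any-cong xs f≗g = cong or (map-cong f≗g xs)

all-false : ∀ {A : Set} (f : A → Bool) {x : A} (xs : List A) →
  x ∈ xs → f x ≡ false → all f xs ≡ false
all-false f (y ∷ xs) (here refl) fy≡false rewrite fy≡false = refl
all-false f (y ∷ xs) (there x∈xs) fx≡false
  rewrite all-false f xs x∈xs fx≡false = ∧-zeroʳ (f y)

==-refl : ∀ {n} (a : Fin n) → (a == a) ≡ true
==-refl a = trans (isYes≗does (a ≟ a)) (dec-true (a ≟ a) refl)

==-distinct : ∀ {n} {a b : Fin n} → ¬ a ≡ b → (a == b) ≡ false
==-distinct {a = a} {b} a≢b = trans (isYes≗does (a ≟ b)) (dec-false (a ≟ b) a≢b)

module _ {n} (G : Graph n) (u v : Fin n) where

  private
    G-e : Graph n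
    G-e = removeEdge G u v

    pair-test-false : ∀ {a b c d : Fin n} → ¬ a ≡ c ⊎ ¬ b ≡ d →
      ((a == c) ∧ (b == d)) ≡ false
    pair-test-false (inj₁ a≢c) rewrite ==-distinct a≢c = refl
    pair-test-false {a} {c = c} (inj₂ b≢d) rewrite ==-distinct b≢d = ∧-zeroʳ (a == c)

  removeEdge-keeps : ∀ a b → ¬ a ≡ u ⊎ ¬ b ≡ v → ¬ a ≡ v ⊎ ¬ b ≡ u →
    adj G-e a b ≡ adj G a b
  removeEdge-keeps a b not-uv not-vu
    rewrite pair-test-false not-uv | pair-test-false not-vu = ∧-identityʳ (adj G a b)

  removeEdge-removes : adj G-e u v ≡ false
  removeEdge-removes rewrite ==-refl u | ==-refl v = ∧-zeroʳ (adj G u v)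

  -- Domination of G - u only sees adjacencies of G - u, so it is the same
  -- in any graph agreeing with G away from u.
  dominatesMinus-cong : (H : Graph n) →
    (∀ a b → ¬ a ≡ u → ¬ b ≡ u → adj H a b ≡ adj G a b) →
    ∀ W → dominatesMinus H u W ≡ dominatesMinus G u W
  -- (If u ∈ W, W is not a subset of V(G - u) in either graph.)
  dominatesMinus-cong H agree W with mem u W in u∈?W
  ... | true  = refl
  ... | false = all-cong (allFin n) dominated
    where
    witness : ∀ w → ¬ w ≡ u → ∀ z → (mem z W ∧ adj H z w) ≡ (mem z W ∧ adj G z w)
    witness w w≢u z with z ≟ u
    ... | yes refl rewrite u∈?W = refl
    ... | no z≢u  = cong (mem z W ∧_) (agree z w z≢u w≢u)

    dominated : ∀ w →
      ((w == u) ∨ mem w W ∨ any (λ z → mem z W ∧ adj H z w) (allFin n)) ≡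
      ((w == u) ∨ mem w W ∨ any (λ z → mem z W ∧ adj G z w) (allFin n))
    dominated w with w ≟ u
    ... | yes refl = refl
    ... | no w≢u  =
      cong (mem w W ∨_) (any-cong (allFin n) (witness w w≢u))

  -- The edge {u,v} is incident to the deleted vertex u.
  dominatesMinus-removeEdge : ∀ W → dominatesMinus G-e u W ≡ dominatesMinus G u W
  dominatesMinus-removeEdge = dominatesMinus-cong G-e
    (λ a b a≢u b≢u → removeEdge-keeps a b (inj₁ a≢u) (inj₂ b≢u))

  avoidsNbhd-v∉W : ∀ W → mem v W ≡ false → avoidsNbhd G u W ≡ avoidsNbhdExcept G u v W
  avoidsNbhd-v∉W W v∉W = all-cong (allFin n) avoids
    where
    avoids : ∀ z → not (adj G u z ∧ mem z W) ≡ ((z == v) ∨ not (adj G u z ∧ mem z W))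
    avoids z with z ≟ v
    ... | yes refl rewrite v∉W | ∧-zeroʳ (adj G u v) = refl
    ... | no z≢v  = refl

  module _ (uv : adj G u v ≡ true) where

    u≢v : ¬ u ≡ v
    u≢v refl = contradiction (trans (sym uv) (irrefl G u)) λ ()

    avoidsNbhd-removeEdge : ∀ W → avoidsNbhd G-e u W ≡ avoidsNbhdExcept G u v W
    avoidsNbhd-removeEdge W = all-cong (allFin n) avoids
      where
      avoids : ∀ z → not (adj G-e u z ∧ mem z W) ≡ ((z == v) ∨ not (adj G u z ∧ mem z W))
      avoids z = by-cases (z ≟ v)
        where
        by-cases : Dec (z ≡ v) →
          not (adj G-e u z ∧ mem z W) ≡ ((z == v) ∨ not (adj G u z ∧ mem z W))
        by-cases (yes refl) rewrite removeEdge-removes | ==-refl v = refl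
        by-cases (no z≢v)
          rewrite removeEdge-keeps u z (inj₂ z≢v) (inj₁ u≢v) | ==-distinct z≢v = refl

    avoidsNbhd-v∈W : ∀ W → mem v W ≡ true → avoidsNbhd G u W ≡ false
    avoidsNbhd-v∈W W v∈W = all-false _ (allFin n) (∈-allFin v) (cong not (cong₂ _∧_ uv v∈W))

    avoidsExcept-split : ∀ W →
      avoidsNbhdExcept G u v W ≡ (mem v W ∧ avoidsNbhdExcept G u v W) ∨ avoidsNbhd G u W
    avoidsExcept-split W with mem v W in v∈?W
    ... | true  rewrite avoidsNbhd-v∈W W v∈?W = sym (∨-identityʳ _)
    ... | false = sym (avoidsNbhd-v∉W W v∈?W)

    avoidsExcept-disjoint : ∀ W →
      (mem v W ∧ avoidsNbhdExcept G u v W) ∧ avoidsNbhd G u W ≡ false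
    avoidsExcept-disjoint W with mem v W in v∈?W
    ... | true  rewrite avoidsNbhd-v∈W W v∈?W = ∧-zeroʳ _
    ... | false = refl

mainTheorem20 : ∀ {n} (G : Graph n) (u v : Fin n) → adj G u v ≡ true →
    ∀ (k : ℕ) → p-vertex (removeEdge G u v) u k ≡ p-edge G u v k + p-vertex G u k
mainTheorem20 {n} G u v uv =
  genPoly-split _ _ _ union
    (λ W → restrictˡ-disjoint (dom W) _ _ (avoidsExcept-disjoint G u v uv W))
  where
  dom : Subset n → Bool
  dom = dominatesMinus G u

  union : ∀ W → dominatesMinus (removeEdge G u v) u W ∧ avoidsNbhd (removeEdge G u v) u W
              ≡ (dom W ∧ (mem v W ∧ avoidsNbhdExcept G u v W)) ∨ (dom W ∧ avoidsNbhd G u W)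
  union W = begin
    dominatesMinus (removeEdge G u v) u W ∧ avoidsNbhd (removeEdge G u v) u W
      ≡⟨ cong₂ _∧_ (dominatesMinus-removeEdge G u v W) (avoidsNbhd-removeEdge G u v uv W) ⟩
    dom W ∧ avoidsNbhdExcept G u v W
      ≡⟨ cong (dom W ∧_) (avoidsExcept-split G u v uv W) ⟩
    dom W ∧ ((mem v W ∧ avoidsNbhdExcept G u v W) ∨ avoidsNbhd G u W)
      ≡⟨ ∧-distribˡ-∨ (dom W) _ _ ⟩
    (dom W ∧ (mem v W ∧ avoidsNbhdExcept G u v W)) ∨ (dom W ∧ avoidsNbhd G u W) ∎
    where open ≡-Reasoning
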